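{- For any integers $k\geq 2$ and $\ell\geq 3$, \[ \mathrm{sat}_k(n,\text{Berge- }K_\ell)\geq (1+o(1))\frac{\ell-2}{k-1}\,n \quad\text{as } n\to\infty. \]
   Context: A hypergraph $\mathcal{H}$ is a Berge-$F$ (for a graph $F$) if $F$ and $\mathcal{H}$ can be embedded on a common vertex set with a bijection $\phi:E(F)\to E(\mathcal{H})$ such that $e\subseteq\phi(e)$ for all $e\in E(F)$; a hypergraph contains a Berge-$F$ if some subset of its edges forms a Berge-$F$. A $k$-uniform hypergraph $\mathcal{H}$ is Berge-$F$-saturated if it contains no Berge-$F$ but $\mathcal{H}+e$ contains a Berge-$F$ for every $k$-set $e\subseteq V(\mathcal{H})$ with $e\notin E(\mathcal{H})$. $\mathrm{sat}_k(n,\text{Berge- }F)$ is the minimum number of edges in a Berge-$F$-saturated $k$-uniform hypergraph on $n$ vertices. $K_\ell$ is the complete graph on $\ell$ vertices. -}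

module Defs where

open import Data.Nat using (ℕ; _≤_; _*_; _∸_)
open import Data.Fin using (Fin) renaming (_<_ to _<ᶠ_)
open import Data.Fin.Subset using (Subset; _∈_; ∣_∣)
open import Data.List using (List; length; lookup; _∷_)
open import Data.List.Relation.Unary.All using (All)
open import Data.List.Relation.Unary.Unique.Propositional using (Unique)
import Data.List.Membership.Propositional as LM
open import Data.Product using (Σ; _×_)
open import Relation.Binary.PropositionalEquality using (_≡_)
open import Relation.Nullary using (¬_)

record Hypergraph (n k : ℕ) : Set where
  field
    edges   : List (Subset n)
    uniform : All (λ e → ∣ e ∣ ≡ k) edges
    simple  : Unique edges
open Hypergraph public

-- The list of edges E contains a Berge-K_ℓ: ℓ distinct core vertices v,
-- and an injective assignment φ of the edges {i,j} (i < j) of K_ℓ to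
-- hyperedges of E (given by position; E is duplicate-free in use), with
-- {v i, v j} ⊆ φ(i,j).
ContainsBergeK : {n : ℕ} → ℕ → List (Subset n) → Set
ContainsBergeK {n} ℓ E =
  Σ (Fin ℓ → Fin n) λ v →
    (∀ a b → v a ≡ v b → a ≡ b) ×
    Σ ((i j : Fin ℓ) → i <ᶠ j → Fin (length E)) λ φ →
      (∀ i j (p : i <ᶠ j) i' j' (p' : i' <ᶠ j') →
         φ i j p ≡ φ i' j' p' → (i ≡ i') × (j ≡ j')) ×
      (∀ i j (p : i <ᶠ j) →
         (v i ∈ lookup E (φ i j p)) × (v j ∈ lookup E (φ i j p)))

BergeKSaturated : {n k : ℕ} → ℕ → Hypergraph n k → Set
BergeKSaturated {n} {k} ℓ H =
  ¬ ContainsBergeK ℓ (edges H) ×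
  (∀ (e : Subset n) → ∣ e ∣ ≡ k → ¬ (e LM.∈ edges H) →
     ContainsBergeK ℓ (e ∷ edges H))

numEdges : {n k : ℕ} → Hypergraph n k → ℕ
numEdges H = length (edges H)

-- Put D = 2m(ℓ − 2) and call a vertex a linked to b if a lies in ℓ − 2 edges each
-- meeting an edge through b. Greedily pick a set S of at most k − 1 vertices of degree < D, no
-- two mutually linked. If S reaches k − 1 vertices, then for a low-degree vertex y sharing no edge
-- with S the k-set S ∪ {y} is not an edge, so adding it creates a Berge-K_ℓ; its two core vertices
-- on the new edge are mutually linked, hence y is linked to S. Either way every low-degree vertex
-- far from S lies in ℓ − 2 edges meeting the neighbourhood N of S. Now count: at most kM/D
-- vertices have degree ≥ D; |N| ≤ (k − 1)(1 + Dk); and an edge meeting N has at most k − 1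
-- vertices outside N, so (ℓ − 2)·#(far vertices) ≤ (k − 1)M. Summing gives
-- (ℓ − 2) n ≤ (1 + 1/m)(k − 1) M + O(1).
--
-- Excluded middle is used for the greedy choice and for asking whether a Berge copy uses the new
-- edge, so the argument runs in the double-negation monad; the final inequality is decidable.
module Submission where

open import Data.Bool using (if_then_else_)
open import Data.Fin using (Fin; zero; suc) renaming (_<_ to _<ᶠ_)
import Data.Fin.Properties as Fin
open import Data.Fin.Subset
  using (Subset; inside; outside; _∈_; _∉_; ∣_∣; _∪_; ⁅_⁆; ⊥; ∁; _-_; Nonempty)
open import Data.Fin.Subset.Properties
  using ( _∈?_; drop-not-there; ∪-identityʳ; ∣⊥∣≡0; ∉⊥; x∈p∪q⁻; x∈p∪q⁺; x∈⁅y⁆⇒x≡y; x∈⁅x⁆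
        ; x≢y⇒x∉⁅y⁆; ∣⁅x⁆∣≡1; x∈∁p⇒x∉p; ∣∁p∣≡n∸∣p∣; x∈p∧x≢y⇒x∈p-y; x∈p⇒∣p-x∣<∣p∣ )
open import Data.List using (List; _∷_; []; length; lookup)
import Data.List.Membership.Propositional as List
open import Data.List.Membership.Propositional.Properties using (∈-lookup)
import Data.List.Relation.Unary.All as All
import Data.List.Relation.Unary.Any as Any
open import Data.List.Relation.Unary.Any.Properties using (lookup-index)
open import Data.Nat using (ℕ; zero; suc; _+_; _*_; _∸_; _≤_; _<_; z≤n; s≤s)
open import Data.Nat.Properties
  using ( +-*-semiring; _≤?_; _<?_; _≟_; ≤-refl; ≤-reflexive; ≤-trans; <⇒≤; ≰⇒>; n≢0⇒n>0; m<n⇒n≢0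
        ; m≤m+n; m≤n+m
        ; +-identityʳ; +-suc; +-mono-≤; +-monoˡ-≤; +-monoʳ-≤; +-cancelʳ-≤; m+[n∸m]≡n; ∸-monoˡ-≤
        ; *-comm; *-identityˡ; *-identityʳ; *-zeroʳ; *-suc; *-mono-≤; *-monoˡ-≤; *-monoʳ-≤
        ; *-cancelˡ-≤; *-cancelʳ-≤; module ≤-Reasoning )
open import Algebra.Properties.Semiring.Sum +-*-semiring
  using (sum; sum-cong-≗; ∑-comm; ∑-distrib-+; *-distribˡ-sum; *-distribʳ-sum)
open import Data.Nat.Tactic.RingSolver using (solve)
open import Data.Product using (Σ; ∃; ∃₂; _×_; _,_; proj₁; proj₂; swap)
open import Data.Sum using (_⊎_; inj₁; inj₂; [_,_]′)
import Data.Vec as Vec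
open import Data.Vec using (here; there)
open import Effect.Monad using (RawMonad)
open import Function using (_∘_)
open import Level using (0ℓ)
open import Relation.Binary using (tri<; tri≈; tri>)
open import Relation.Binary.PropositionalEquality
  using (_≡_; _≢_; refl; sym; trans; cong; cong₂; subst; module ≡-Reasoning)
open import Relation.Nullary using (¬_)
open import Relation.Nullary.Decidable
  using (Dec; yes; no; does; _×-dec_; decidable-stable; ¬¬-excluded-middle)
open import Relation.Nullary.Negation using (contradiction; ¬¬-map; ¬¬-Monad)
open RawMonad (¬¬-Monad {a = 0ℓ}) using (return; _>>=_)

open import Defs

𝟙 : ∀ {A : Set} → Dec A → ℕ
𝟙 a? = if does a? then 1 else 0

𝟙≤1 : ∀ {A : Set} (a? : Dec A) → 𝟙 a? ≤ 1
𝟙≤1 (yes _) = ≤-refl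
𝟙≤1 (no _)  = z≤n

𝟙≡1 : ∀ {A : Set} (a? : Dec A) → A → 𝟙 a? ≡ 1
𝟙≡1 (yes _) _ = refl
𝟙≡1 (no ¬a) a = contradiction a ¬a

0<𝟙⇒ : ∀ {A : Set} (a? : Dec A) → 0 < 𝟙 a? → A
0<𝟙⇒ (yes a) _ = a

0<𝟙*⇒ : ∀ {A : Set} (a? : Dec A) m → 0 < 𝟙 a? * m → A × 0 < m
0<𝟙*⇒ (yes a) m 0<m+0 = a , subst (0 <_) (+-identityʳ m) 0<m+0

χ : ∀ {n} → Subset n → Fin n → ℕ
χ p x = 𝟙 (x ∈? p)

sum-const : ∀ n c → sum {n} (λ _ → c) ≡ n * c
sum-const zero    c = refl
sum-const (suc n) c = cong (c +_) (sum-const n c)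

sum-mono-≤ : ∀ {n} {f g : Fin n → ℕ} → (∀ i → f i ≤ g i) → sum f ≤ sum g
sum-mono-≤ {zero}  f≤g = z≤n
sum-mono-≤ {suc n} f≤g = +-mono-≤ (f≤g zero) (sum-mono-≤ (f≤g ∘ suc))

term≤sum : ∀ {n} (f : Fin n → ℕ) i → f i ≤ sum f
term≤sum f zero    = m≤m+n _ _
term≤sum f (suc i) = ≤-trans (term≤sum (f ∘ suc) i) (m≤n+m _ _)

0<sum⇒∃0<term : ∀ {n} (f : Fin n → ℕ) → 0 < sum f → ∃ λ i → 0 < f i
0<sum⇒∃0<term {suc n} f 0<∑ with f zero in eq
... | suc _ = zero , subst (0 <_) (sym eq) (s≤s z≤n)
... | zero  = let i , 0<fi = 0<sum⇒∃0<term (f ∘ suc) 0<∑ in suc i , 0<fi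

∣p∣≡∑χ : ∀ {n} (p : Subset n) → ∣ p ∣ ≡ sum (χ p)
∣p∣≡∑χ Vec.[]              = refl
∣p∣≡∑χ (inside  Vec.∷ p) = cong suc (∣p∣≡∑χ p)
∣p∣≡∑χ (outside Vec.∷ p) = ∣p∣≡∑χ p

x∈p⇒χ≡1 : ∀ {n} {p : Subset n} {x} → x ∈ p → χ p x ≡ 1
x∈p⇒χ≡1 {p = p} {x} = 𝟙≡1 (x ∈? p)

∣p∣≤sum : ∀ {n} (p : Subset n) (f : Fin n → ℕ) → (∀ {i} → i ∈ p → 1 ≤ f i) → ∣ p ∣ ≤ sum f
∣p∣≤sum p f 1≤f = ≤-trans (≤-reflexive (∣p∣≡∑χ p)) (sum-mono-≤ χ≤f)
  where
  χ≤f : ∀ i → χ p i ≤ f i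
  χ≤f i with i ∈? p
  ... | yes i∈p = 1≤f i∈p
  ... | no _    = z≤n

sum≤∣p∣ : ∀ {n} (p : Subset n) (f : Fin n → ℕ) → (∀ i → f i ≤ 1) → (∀ {i} → 0 < f i → i ∈ p) → sum f ≤ ∣ p ∣
sum≤∣p∣ p f f≤1 0<f⇒∈p = ≤-trans (sum-mono-≤ f≤χ) (≤-reflexive (sym (∣p∣≡∑χ p)))
  where
  f≤χ : ∀ i → f i ≤ χ p i
  f≤χ i with f i in eq
  ... | zero  = z≤n
  ... | suc _ = begin
    suc _   ≤⟨ subst (_≤ 1) eq (f≤1 i) ⟩
    1       ≡⟨ sym (x∈p⇒χ≡1 (0<f⇒∈p (subst (0 <_) (sym eq) (s≤s z≤n)))) ⟩
    χ p i   ∎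
    where open ≤-Reasoning

∑χ*≤∣p∣* : ∀ {n} (p : Subset n) (g : Fin n → ℕ) c → (∀ {i} → i ∈ p → g i ≤ c) →
           sum (λ i → χ p i * g i) ≤ ∣ p ∣ * c
∑χ*≤∣p∣* p g c g≤c = begin
  sum (λ i → χ p i * g i)  ≤⟨ sum-mono-≤ χg≤χc ⟩
  sum (λ i → χ p i * c)    ≡⟨ sym (*-distribʳ-sum c (χ p)) ⟩
  sum (χ p) * c            ≡⟨ cong (_* c) (sym (∣p∣≡∑χ p)) ⟩
  ∣ p ∣ * c                ∎
  where
  open ≤-Reasoning
  χg≤χc : ∀ i → χ p i * g i ≤ χ p i * c
  χg≤χc i with i ∈? p
  ... | yes i∈p = *-monoʳ-≤ 1 (g≤c i∈p)
  ... | no _    = z≤n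

0<∣p∣⇒nonempty : ∀ {n} (p : Subset n) → 0 < ∣ p ∣ → Nonempty p
0<∣p∣⇒nonempty p 0<∣p∣ with 0<sum⇒∃0<term (χ p) (subst (0 <_) (∣p∣≡∑χ p) 0<∣p∣)
... | x , 0<χpx = x , 0<𝟙⇒ (x ∈? p) 0<χpx

x∈p∪⁅y⁆⁻ : ∀ {n} {p : Subset n} {x y} → x ∈ p ∪ ⁅ y ⁆ → x ∈ p ⊎ x ≡ y
x∈p∪⁅y⁆⁻ {p = p} {y = y} x∈ with x∈p∪q⁻ p ⁅ y ⁆ x∈
... | inj₁ x∈p   = inj₁ x∈p
... | inj₂ x∈⁅y⁆ = inj₂ (x∈⁅y⁆⇒x≡y y x∈⁅y⁆)

∣p∪⁅x⁆∣≡1+∣p∣ : ∀ {n} {x : Fin n} (p : Subset n) → x ∉ p → ∣ p ∪ ⁅ x ⁆ ∣ ≡ suc ∣ p ∣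
∣p∪⁅x⁆∣≡1+∣p∣ {x = zero}  (inside  Vec.∷ p) x∉p = contradiction here x∉p
∣p∪⁅x⁆∣≡1+∣p∣ {x = zero}  (outside Vec.∷ p) x∉p = cong (suc ∘ ∣_∣) (∪-identityʳ p)
∣p∪⁅x⁆∣≡1+∣p∣ {x = suc x} (inside  Vec.∷ p) x∉p = cong suc (∣p∪⁅x⁆∣≡1+∣p∣ p (drop-not-there x∉p))
∣p∪⁅x⁆∣≡1+∣p∣ {x = suc x} (outside Vec.∷ p) x∉p = ∣p∪⁅x⁆∣≡1+∣p∣ p (drop-not-there x∉p)

∣∁⁅x⁆∪⁅y⁆∣≡n∸2 : ∀ {n} {x y : Fin n} → x ≢ y → ∣ ∁ (⁅ x ⁆ ∪ ⁅ y ⁆) ∣ ≡ n ∸ 2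
∣∁⁅x⁆∪⁅y⁆∣≡n∸2 {n} {x} {y} x≢y = trans (∣∁p∣≡n∸∣p∣ (⁅ x ⁆ ∪ ⁅ y ⁆))
  (cong (n ∸_) (trans (∣p∪⁅x⁆∣≡1+∣p∣ ⁅ x ⁆ (x≢y⇒x∉⁅y⁆ (x≢y ∘ sym))) (cong suc (∣⁅x⁆∣≡1 x))))

z∈∁⁅x⁆∪⁅y⁆⇒ : ∀ {n} {x y z : Fin n} → z ∈ ∁ (⁅ x ⁆ ∪ ⁅ y ⁆) → x ≢ z × y ≢ z
z∈∁⁅x⁆∪⁅y⁆⇒ {x = x} {y} z∈ =
  (λ { refl → x∈∁p⇒x∉p z∈ (x∈p∪q⁺ (inj₁ (x∈⁅x⁆ x))) }) ,
  (λ { refl → x∈∁p⇒x∉p z∈ (x∈p∪q⁺ (inj₂ (x∈⁅x⁆ y))) })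

InjectiveOn : ∀ {r m} → Subset r → (Fin r → Fin m) → Set
InjectiveOn Q G = ∀ {t t′} → t ∈ Q → t′ ∈ Q → G t ≡ G t′ → t ≡ t′

injectiveOn-tail : ∀ {r m} {b} {Q : Subset r} {G : Fin (suc r) → Fin m} →
                   InjectiveOn (b Vec.∷ Q) G → InjectiveOn Q (G ∘ suc)
injectiveOn-tail inj t∈ t′∈ = Fin.suc-injective ∘ inj (there t∈) (there t′∈)

image : ∀ {r m} (Q : Subset r) (G : Fin r → Fin m) → InjectiveOn Q G →
  Σ (Subset m) λ F → ∣ F ∣ ≡ ∣ Q ∣ × (∀ {f} → f ∈ F → ∃ λ t → t ∈ Q × G t ≡ f)
image {m = m} Vec.[] G inj = ⊥ , ∣⊥∣≡0 m , λ f∈⊥ → contradiction f∈⊥ ∉⊥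
image (outside Vec.∷ Q) G inj with image Q (G ∘ suc) (injectiveOn-tail inj)
... | F , ∣F∣≡∣Q∣ , preimage =
  F , ∣F∣≡∣Q∣ , λ f∈F → let t , t∈Q , Gt≡f = preimage f∈F in suc t , there t∈Q , Gt≡f
image (inside Vec.∷ Q) G inj with image Q (G ∘ suc) (injectiveOn-tail inj)
... | F , ∣F∣≡∣Q∣ , preimage =
  F ∪ ⁅ G zero ⁆ , trans (∣p∪⁅x⁆∣≡1+∣p∣ F G₀∉F) (cong suc ∣F∣≡∣Q∣) , preimage′
  where
  G₀∉F : G zero ∉ F
  G₀∉F G₀∈F = let t , t∈Q , Gt≡G₀ = preimage G₀∈F in contradiction (inj here (there t∈Q) (sym Gt≡G₀)) λ ()
  preimage′ : ∀ {f} → f ∈ F ∪ ⁅ G zero ⁆ → ∃ λ t → t ∈ inside Vec.∷ Q × G t ≡ f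
  preimage′ f∈ with x∈p∪⁅y⁆⁻ f∈
  ... | inj₁ f∈F  = let t , t∈Q , Gt≡f = preimage f∈F in suc t , there t∈Q , Gt≡f
  ... | inj₂ f≡G₀ = zero , here , sym f≡G₀

∣tail∣≡∣∣ : ∀ {m} (p : Subset (suc m)) → zero ∉ p → ∣ Vec.tail p ∣ ≡ ∣ p ∣
∣tail∣≡∣∣ (inside  Vec.∷ p) 0∉p = contradiction here 0∉p
∣tail∣≡∣∣ (outside Vec.∷ p) 0∉p = refl

x≢0⇒x≡suc : ∀ {m} (x : Fin (suc m)) → x ≢ zero → ∃ λ y → x ≡ suc y
x≢0⇒x≡suc zero    x≢0 = contradiction refl x≢0
x≢0⇒x≡suc (suc y) _   = y , refl

x∈tail⇒suc-x∈p : ∀ {m} (p : Subset (suc m)) {x} → x ∈ Vec.tail p → suc x ∈ p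
x∈tail⇒suc-x∈p (_ Vec.∷ p) x∈p = there x∈p

module BergeExtension {n : ℕ} (ℓ : ℕ) (E : List (Subset n)) where

  Adjacent : Fin n → Fin n → Set
  Adjacent c b = ∃ λ g → c ∈ lookup E g × b ∈ lookup E g

  -- What a Berge-K_ℓ through a new edge ∋ a, b leaves in E: the ℓ − 2 edges from a to the other
  -- core vertices, each containing a core vertex that shares an edge with b.
  Linked : Fin n → Fin n → Set
  Linked a b = Σ (Subset (length E)) λ F → ℓ ∸ 2 ≤ ∣ F ∣ ×
    (∀ {f} → f ∈ F → a ∈ lookup E f × ∃ λ c → c ∈ lookup E f × Adjacent c b)

  LinkedPairIn : Subset n → Set
  LinkedPairIn e = ∃₂ λ a b → a ≢ b × a ∈ e × b ∈ e × Linked a b × Linked b a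

  module BergeCopy (e : Subset n) (v : Fin ℓ → Fin n) (v-injective : ∀ a b → v a ≡ v b → a ≡ b)
    (φ : (i j : Fin ℓ) → i <ᶠ j → Fin (suc (length E)))
    (φ-injective : ∀ i j (p : i <ᶠ j) i′ j′ (p′ : i′ <ᶠ j′) → φ i j p ≡ φ i′ j′ p′ → i ≡ i′ × j ≡ j′)
    (φ-covers : ∀ i j (p : i <ᶠ j) → v i ∈ lookup (e ∷ E) (φ i j p) × v j ∈ lookup (e ∷ E) (φ i j p))
    where

    φ-irrelevant : ∀ i j (p p′ : i <ᶠ j) → φ i j p ≡ φ i j p′
    φ-irrelevant i j p p′ = cong (φ i j) (Fin.<-irrelevant p p′)

    -- φ extended symmetrically; the value on the diagonal is a dummy.
    ψ : Fin ℓ → Fin ℓ → Fin (suc (length E))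
    ψ a b with Fin.<-cmp a b
    ... | tri< a<b _ _ = φ a b a<b
    ... | tri≈ _ _ _   = zero
    ... | tri> _ _ b<a = φ b a b<a

    ψ≡φ : ∀ i j (p : i <ᶠ j) → ψ i j ≡ φ i j p
    ψ≡φ i j p with Fin.<-cmp i j
    ... | tri< p′ _ _ = φ-irrelevant i j p′ p
    ... | tri≈ _ i≡j _ = contradiction p (Fin.<-irrefl i≡j)
    ... | tri> _ _ j<i = contradiction j<i (Fin.<-asym p)

    ψ˘≡φ : ∀ i j (p : i <ᶠ j) → ψ j i ≡ φ i j p
    ψ˘≡φ i j p with Fin.<-cmp j i
    ... | tri< j<i _ _ = contradiction j<i (Fin.<-asym p)
    ... | tri≈ _ j≡i _ = contradiction p (Fin.<-irrefl (sym j≡i))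
    ... | tri> _ _ p′ = φ-irrelevant i j p′ p

    ψ-sym : ∀ {a b} → a ≢ b → ψ a b ≡ ψ b a
    ψ-sym {a} {b} a≢b with Fin.<-cmp a b
    ... | tri< a<b _ _ = sym (ψ˘≡φ a b a<b)
    ... | tri≈ _ a≡b _ = contradiction a≡b a≢b
    ... | tri> _ _ b<a = sym (ψ≡φ b a b<a)

    ψ-injective : ∀ {a b a′ b′} → a ≢ b → a′ ≢ b′ → ψ a b ≡ ψ a′ b′ →
                  (a ≡ a′ × b ≡ b′) ⊎ (a ≡ b′ × b ≡ a′)
    ψ-injective {a} {b} {a′} {b′} a≢b a′≢b′ eq with Fin.<-cmp a b | Fin.<-cmp a′ b′
    ... | tri≈ _ a≡b _ | _ = contradiction a≡b a≢b
    ... | _ | tri≈ _ a′≡b′ _ = contradiction a′≡b′ a′≢b′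
    ... | tri< p _ _ | tri< q _ _ = inj₁ (φ-injective _ _ p _ _ q eq)
    ... | tri< p _ _ | tri> _ _ q = inj₂ (φ-injective _ _ p _ _ q eq)
    ... | tri> _ _ p | tri< q _ _ = inj₂ (swap (φ-injective _ _ p _ _ q eq))
    ... | tri> _ _ p | tri> _ _ q = inj₁ (swap (φ-injective _ _ p _ _ q eq))

    ψ-injectiveʳ : ∀ {a b b′} → a ≢ b → a ≢ b′ → ψ a b ≡ ψ a b′ → b ≡ b′
    ψ-injectiveʳ a≢b a≢b′ eq with ψ-injective a≢b a≢b′ eq
    ... | inj₁ (_ , b≡b′) = b≡b′
    ... | inj₂ (a≡b′ , _) = contradiction a≡b′ a≢b′

    ψ-covers : ∀ {a b} → a ≢ b → v a ∈ lookup (e ∷ E) (ψ a b) × v b ∈ lookup (e ∷ E) (ψ a b)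
    ψ-covers {a} {b} a≢b with Fin.<-cmp a b
    ... | tri< a<b _ _ = φ-covers a b a<b
    ... | tri≈ _ a≡b _ = contradiction a≡b a≢b
    ... | tri> _ _ b<a = swap (φ-covers b a b<a)

    oldEdge-adjacent : ∀ {a b} → a ≢ b → ψ a b ≢ zero → Adjacent (v a) (v b)
    oldEdge-adjacent {a} {b} a≢b ψ≢0 with x≢0⇒x≡suc (ψ a b) ψ≢0
    ... | g , ψab≡g = g , subst (λ h → v a ∈ lookup (e ∷ E) h × v b ∈ lookup (e ∷ E) h) ψab≡g (ψ-covers a≢b)

    avoidsNewEdge⇒BergeK : (∀ i j p → φ i j p ≢ zero) → ContainsBergeK ℓ E
    avoidsNewEdge⇒BergeK φ≢0 = v , v-injective , φ′ , φ′-injective , φ′-covers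
      where
      φ′ : (i j : Fin ℓ) → i <ᶠ j → Fin (length E)
      φ′ i j p = proj₁ (x≢0⇒x≡suc (φ i j p) (φ≢0 i j p))
      φ≡sucφ′ : ∀ i j p → φ i j p ≡ suc (φ′ i j p)
      φ≡sucφ′ i j p = proj₂ (x≢0⇒x≡suc (φ i j p) (φ≢0 i j p))
      φ′-injective : ∀ i j (p : i <ᶠ j) i′ j′ (p′ : i′ <ᶠ j′) → φ′ i j p ≡ φ′ i′ j′ p′ → i ≡ i′ × j ≡ j′
      φ′-injective i j p i′ j′ p′ eq =
        φ-injective i j p i′ j′ p′ (trans (φ≡sucφ′ i j p) (trans (cong suc eq) (sym (φ≡sucφ′ i′ j′ p′))))
      φ′-covers : ∀ i j (p : i <ᶠ j) → v i ∈ lookup E (φ′ i j p) × v j ∈ lookup E (φ′ i j p)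
      φ′-covers i j p =
        subst (λ g → v i ∈ lookup (e ∷ E) g × v j ∈ lookup (e ∷ E) g) (φ≡sucφ′ i j p) (φ-covers i j p)

    newEdge⇒linked : ∀ {i j} → i ≢ j → ψ i j ≡ zero → Linked (v i) (v j)
    newEdge⇒linked {i} {j} i≢j ψij≡0 = Vec.tail F₀ , ℓ∸2≤∣F∣ , edgeOf
      where
      Q : Subset ℓ
      Q = ∁ (⁅ i ⁆ ∪ ⁅ j ⁆)
      t∈Q⇒i≢t : ∀ {t} → t ∈ Q → i ≢ t
      t∈Q⇒i≢t = proj₁ ∘ z∈∁⁅x⁆∪⁅y⁆⇒
      t∈Q⇒j≢t : ∀ {t} → t ∈ Q → j ≢ t
      t∈Q⇒j≢t = proj₂ ∘ z∈∁⁅x⁆∪⁅y⁆⇒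
      ψi≢0 : ∀ {t} → t ∈ Q → ψ i t ≢ zero
      ψi≢0 t∈Q ψit≡0 = t∈Q⇒j≢t t∈Q (sym (ψ-injectiveʳ (t∈Q⇒i≢t t∈Q) i≢j (trans ψit≡0 (sym ψij≡0))))
      ψj≢0 : ∀ {t} → t ∈ Q → ψ j t ≢ zero
      ψj≢0 t∈Q ψjt≡0 = t∈Q⇒i≢t t∈Q (sym (ψ-injectiveʳ (t∈Q⇒j≢t t∈Q) (i≢j ∘ sym)
        (trans ψjt≡0 (trans (sym ψij≡0) (ψ-sym i≢j)))))
      image₀ = image Q (ψ i) λ t∈Q t′∈Q → ψ-injectiveʳ (t∈Q⇒i≢t t∈Q) (t∈Q⇒i≢t t′∈Q)
      F₀ = proj₁ image₀
      0∉F₀ : zero ∉ F₀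
      0∉F₀ 0∈F₀ = let t , t∈Q , ψit≡0 = proj₂ (proj₂ image₀) 0∈F₀ in ψi≢0 t∈Q ψit≡0
      ℓ∸2≤∣F∣ : ℓ ∸ 2 ≤ ∣ Vec.tail F₀ ∣
      ℓ∸2≤∣F∣ = ≤-reflexive (sym (begin
        ∣ Vec.tail F₀ ∣  ≡⟨ ∣tail∣≡∣∣ F₀ 0∉F₀ ⟩
        ∣ F₀ ∣           ≡⟨ proj₁ (proj₂ image₀) ⟩
        ∣ Q ∣            ≡⟨ ∣∁⁅x⁆∪⁅y⁆∣≡n∸2 i≢j ⟩
        ℓ ∸ 2            ∎))
        where open ≡-Reasoning
      edgeOf : ∀ {f} → f ∈ Vec.tail F₀ → v i ∈ lookup E f × ∃ λ c → c ∈ lookup E f × Adjacent c (v j)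
      edgeOf {f} f∈F with proj₂ (proj₂ image₀) (x∈tail⇒suc-x∈p F₀ f∈F)
      ... | t , t∈Q , ψit≡f = let vi∈ , vt∈ = ψ-covers (t∈Q⇒i≢t t∈Q) in
        subst (λ g → v i ∈ lookup (e ∷ E) g) ψit≡f vi∈ ,
        v t , subst (λ g → v t ∈ lookup (e ∷ E) g) ψit≡f vt∈ ,
        oldEdge-adjacent (t∈Q⇒j≢t t∈Q ∘ sym) (λ ψtj≡0 → ψj≢0 t∈Q (trans (ψ-sym (t∈Q⇒j≢t t∈Q)) ψtj≡0))

  newEdge⇒linkedPair : ∀ {e} → ContainsBergeK ℓ (e ∷ E) → ¬ ContainsBergeK ℓ E → ¬ ¬ LinkedPairIn e
  newEdge⇒linkedPair {e} (v , v-injective , φ , φ-injective , φ-covers) noBergeK noLinkedPair =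
    noBergeK (avoidsNewEdge⇒BergeK λ i j p φij≡0 → noLinkedPair (linkedPair i j p φij≡0))
    where
    open BergeCopy e v v-injective φ φ-injective φ-covers
    linkedPair : ∀ i j (p : i <ᶠ j) → φ i j p ≡ zero → LinkedPairIn e
    linkedPair i j p φij≡0 =
      v i , v j , i≢j ∘ v-injective i j , vi∈e , vj∈e ,
      newEdge⇒linked i≢j (trans (ψ≡φ i j p) φij≡0) , newEdge⇒linked (i≢j ∘ sym) (trans (ψ˘≡φ i j p) φij≡0)
      where
      i≢j : i ≢ j
      i≢j i≡j = Fin.<-irrefl i≡j p
      vi∈e : v i ∈ e
      vi∈e = subst (λ g → v i ∈ lookup (e ∷ E) g) φij≡0 (proj₁ (φ-covers i j p))
      vj∈e : v j ∈ e
      vj∈e = subst (λ g → v j ∈ lookup (e ∷ E) g) φij≡0 (proj₂ (φ-covers i j p))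

module Degrees {n k : ℕ} (H : Hypergraph n k) where

  edge : Fin (numEdges H) → Subset n
  edge = lookup (edges H)

  degree : Fin n → ℕ
  degree y = sum λ f → χ (edge f) y

  codegree : Fin n → Fin n → ℕ
  codegree x y = sum λ f → χ (edge f) x * χ (edge f) y

  ∑χ-edge≡k : ∀ f → sum (χ (edge f)) ≡ k
  ∑χ-edge≡k f = trans (sym (∣p∣≡∑χ (edge f))) (All.lookup (uniform H) (∈-lookup f))

  ∑degree≡numEdges*k : sum degree ≡ numEdges H * k
  ∑degree≡numEdges*k = begin
    sum (λ y → sum λ f → χ (edge f) y)  ≡⟨ ∑-comm (λ y f → χ (edge f) y) ⟩
    sum (λ f → sum (χ (edge f)))        ≡⟨ sum-cong-≗ ∑χ-edge≡k ⟩
    sum {numEdges H} (λ _ → k)          ≡⟨ sum-const (numEdges H) k ⟩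
    numEdges H * k                      ∎
    where open ≡-Reasoning

  ∑codegree≡degree*k : ∀ x → sum (codegree x) ≡ degree x * k
  ∑codegree≡degree*k x = begin
    sum (λ y → sum λ f → χ (edge f) x * χ (edge f) y)  ≡⟨ ∑-comm (λ y f → χ (edge f) x * χ (edge f) y) ⟩
    sum (λ f → sum λ y → χ (edge f) x * χ (edge f) y)
      ≡⟨ sum-cong-≗ (λ f → sym (*-distribˡ-sum (χ (edge f) x) (χ (edge f)))) ⟩
    sum (λ f → χ (edge f) x * sum (χ (edge f)))
      ≡⟨ sum-cong-≗ (λ f → cong (χ (edge f) x *_) (∑χ-edge≡k f)) ⟩
    sum (λ f → χ (edge f) x * k)                       ≡⟨ sym (*-distribʳ-sum k (λ f → χ (edge f) x)) ⟩
    degree x * k                                       ∎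
    where open ≡-Reasoning

module SaturatedHypergraph {n k ℓ : ℕ} (H : Hypergraph n k) (sat : BergeKSaturated ℓ H) where

  open BergeExtension ℓ (edges H)

  open Degrees H

  -- Positive exactly on S and on the vertices sharing an edge with S.
  weight : Subset n → Fin n → ℕ
  weight S y = χ S y + sum λ s → χ S s * codegree s y

  ∈⇒0<weight : ∀ {S y} → y ∈ S → 0 < weight S y
  ∈⇒0<weight {S} {y} y∈S = ≤-trans (≤-reflexive (sym (x∈p⇒χ≡1 y∈S))) (m≤m+n (χ S y) _)

  weight≡0⇒∉ : ∀ {S y} → weight S y ≡ 0 → y ∉ S
  weight≡0⇒∉ w≡0 y∈S = m<n⇒n≢0 (∈⇒0<weight y∈S) w≡0

  adjacent⇒0<weight : ∀ {S s y} → s ∈ S → Adjacent y s → 0 < weight S y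
  adjacent⇒0<weight {S} {s} {y} s∈S (g , y∈g , s∈g) = begin
    1
      ≡⟨ cong₂ _*_ (sym (x∈p⇒χ≡1 s∈S)) (cong₂ _*_ (sym (x∈p⇒χ≡1 s∈g)) (sym (x∈p⇒χ≡1 y∈g))) ⟩
    χ S s * (χ (edge g) s * χ (edge g) y)
      ≤⟨ *-monoʳ-≤ (χ S s) (term≤sum (λ f → χ (edge f) s * χ (edge f) y) g) ⟩
    χ S s * codegree s y                   ≤⟨ term≤sum (λ s → χ S s * codegree s y) s ⟩
    sum (λ s → χ S s * codegree s y)       ≤⟨ m≤n+m _ (χ S y) ⟩
    weight S y                             ∎
    where open ≤-Reasoning

  Independent : Subset n → Set
  Independent S = ∀ {a b} → a ∈ S → b ∈ S → a ≢ b → ¬ (Linked a b × Linked b a)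

  insert-independent : ∀ {S x} → Independent S → (∀ {s} → s ∈ S → ¬ (Linked x s × Linked s x)) →
                       Independent (S ∪ ⁅ x ⁆)
  insert-independent independent x-unlinked a∈ b∈ a≢b (a→b , b→a) with x∈p∪⁅y⁆⁻ a∈ | x∈p∪⁅y⁆⁻ b∈
  ... | inj₁ a∈S  | inj₁ b∈S  = independent a∈S b∈S a≢b (a→b , b→a)
  ... | inj₁ a∈S  | inj₂ refl = x-unlinked a∈S (b→a , a→b)
  ... | inj₂ refl | inj₁ b∈S  = x-unlinked b∈S (a→b , b→a)
  ... | inj₂ refl | inj₂ refl = a≢b refl

  module _ (2≤k : 2 ≤ k) where

    full-independent⇒linksRemote : ∀ {S} → ∣ S ∣ ≡ k ∸ 1 → Independent S →
      ∀ {y} → weight S y ≡ 0 → ¬ ¬ ∃ λ s → s ∈ S × Linked y s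
    full-independent⇒linksRemote {S} ∣S∣≡k∸1 independent {y} w≡0 =
      ¬¬-map linkedToS (newEdge⇒linkedPair (proj₂ sat e ∣e∣≡k e∉H) (proj₁ sat))
      where
      e : Subset n
      e = S ∪ ⁅ y ⁆
      ∣e∣≡k : ∣ e ∣ ≡ k
      ∣e∣≡k = begin
        ∣ e ∣        ≡⟨ ∣p∪⁅x⁆∣≡1+∣p∣ S (weight≡0⇒∉ w≡0) ⟩
        suc ∣ S ∣    ≡⟨ cong suc ∣S∣≡k∸1 ⟩
        suc (k ∸ 1)  ≡⟨ m+[n∸m]≡n (≤-trans (s≤s z≤n) 2≤k) ⟩
        k            ∎
        where open ≡-Reasoning
      e∉H : ¬ (e List.∈ edges H)
      e∉H e∈H with 0<∣p∣⇒nonempty S (subst (0 <_) (sym ∣S∣≡k∸1) (∸-monoˡ-≤ 1 2≤k))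
      ... | s , s∈S = m<n⇒n≢0 (adjacent⇒0<weight s∈S y~s) w≡0
        where
        inEdge : ∀ {x} → x ∈ e → x ∈ edge (Any.index e∈H)
        inEdge = subst (_ ∈_) (lookup-index e∈H)
        y~s : Adjacent y s
        y~s = Any.index e∈H , inEdge (x∈p∪q⁺ (inj₂ (x∈⁅x⁆ y))) , inEdge (x∈p∪q⁺ (inj₁ s∈S))
      linkedToS : LinkedPairIn e → ∃ λ s → s ∈ S × Linked y s
      linkedToS (a , b , a≢b , a∈e , b∈e , a→b , b→a) with x∈p∪⁅y⁆⁻ a∈e | x∈p∪⁅y⁆⁻ b∈e
      ... | inj₁ a∈S  | inj₁ b∈S  = contradiction (a→b , b→a) (independent a∈S b∈S a≢b)
      ... | inj₁ a∈S  | inj₂ refl = a , a∈S , b→a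
      ... | inj₂ refl | inj₁ b∈S  = b , b∈S , a→b
      ... | inj₂ refl | inj₂ refl = contradiction refl a≢b

    module _ (D : ℕ) where

      LowDegree : Subset n → Set
      LowDegree S = ∀ {s} → s ∈ S → degree s < D

      Remote : Subset n → Fin n → Set
      Remote S y = degree y < D × weight S y ≡ 0

      remote? : ∀ S y → Dec (Remote S y)
      remote? S y = degree y <? D ×-dec weight S y ≟ 0

      record LinkingSet (S : Subset n) : Set where
        field
          size        : ∣ S ∣ ≤ k ∸ 1
          lowDegree   : LowDegree S
          linksRemote : ∀ {y} → Remote S y → ¬ ¬ ∃ λ s → s ∈ S × Linked y s

      Candidate : Subset n → Set
      Candidate S = ∃ λ x → degree x < D × x ∉ S × ∀ {s} → s ∈ S → ¬ (Linked x s × Linked s x)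

      insert-lowDegree : ∀ {S x} → LowDegree S → degree x < D → LowDegree (S ∪ ⁅ x ⁆)
      insert-lowDegree low degx<D s∈ = [ low , (λ { refl → degx<D }) ]′ (x∈p∪⁅y⁆⁻ s∈)

      greedy-extend : ∀ j {S} → ∣ S ∣ + j ≡ k ∸ 1 → LowDegree S → Independent S → ¬ ¬ ∃ LinkingSet
      greedy-extend zero {S} ∣S∣+0≡k∸1 low independent = return (S , record
        { size        = ≤-reflexive ∣S∣≡k∸1
        ; lowDegree   = low
        ; linksRemote = full-independent⇒linksRemote ∣S∣≡k∸1 independent ∘ proj₂
        })
        where ∣S∣≡k∸1 = trans (sym (+-identityʳ ∣ S ∣)) ∣S∣+0≡k∸1
      greedy-extend (suc j) {S} ∣S∣+1+j≡k∸1 low independent = do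
        yes (x , degx<D , x∉S , x-unlinked) ← ¬¬-excluded-middle {A = Candidate S}
          where no noCandidate → return (S , record
                  { size        = ≤-trans (m≤m+n ∣ S ∣ (suc j)) (≤-reflexive ∣S∣+1+j≡k∸1)
                  ; lowDegree   = low
                  ; linksRemote = λ {y} (degy<D , w≡0) noLink → noCandidate
                      (y , degy<D , weight≡0⇒∉ w≡0 , λ s∈S (y→s , _) → noLink (_ , s∈S , y→s))
                  })
        greedy-extend j
          (trans (cong (_+ j) (∣p∪⁅x⁆∣≡1+∣p∣ S x∉S)) (trans (sym (+-suc ∣ S ∣ j)) ∣S∣+1+j≡k∸1))
          (insert-lowDegree low degx<D) (insert-independent independent x-unlinked)

      linkingSet-exists : ¬ ¬ ∃ LinkingSet
      linkingSet-exists = greedy-extend (k ∸ 1) (cong (_+ (k ∸ 1)) (∣⊥∣≡0 n))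
        (λ s∈⊥ → contradiction s∈⊥ ∉⊥) (λ a∈⊥ → contradiction a∈⊥ ∉⊥)

      module Counting {S} (linking : LinkingSet S) where
        open LinkingSet linking

        high remote : Fin n → ℕ
        high y   = 𝟙 (D ≤? degree y)
        remote y = 𝟙 (remote? S y)

        marked : Fin (numEdges H) → ℕ
        marked f = 𝟙 (0 <? sum λ z → χ (edge f) z * weight S z)

        markedDegree : Fin n → ℕ
        markedDegree y = sum λ f → marked f * χ (edge f) y

        vertex-counted : ∀ y → 1 ≤ high y + weight S y + remote y
        vertex-counted y = counted (D ≤? degree y) (degree y <? D) (weight S y ≟ 0)
          where
          counted : (high? : Dec (D ≤ degree y)) (low? : Dec (degree y < D)) (w≡0? : Dec (weight S y ≡ 0)) →
                    1 ≤ 𝟙 high? + weight S y + 𝟙 (low? ×-dec w≡0?)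
          counted (yes _)     _          _          = s≤s z≤n
          counted (no D≰degy) (no degy≮D) _         = contradiction (≰⇒> D≰degy) degy≮D
          counted (no _)      (yes _)    (yes _)    = m≤n+m 1 (0 + weight S y)
          counted high?       _          (no w≢0)   =
            ≤-trans (n≢0⇒n>0 w≢0) (≤-trans (m≤n+m (weight S y) (𝟙 high?)) (m≤m+n _ _))

        n≤∑high+∑weight+∑remote : n ≤ sum high + sum (weight S) + sum remote
        n≤∑high+∑weight+∑remote = begin
          n                                                ≡⟨ sym (trans (sum-const n 1) (*-identityʳ n)) ⟩
          sum {n} (λ _ → 1)                                ≤⟨ sum-mono-≤ vertex-counted ⟩
          sum (λ y → high y + weight S y + remote y)       ≡⟨ ∑-distrib-+ _ remote ⟩
          sum (λ y → high y + weight S y) + sum remote     ≡⟨ cong (_+ sum remote) (∑-distrib-+ high _) ⟩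
          sum high + sum (weight S) + sum remote           ∎
          where open ≤-Reasoning

        D*∑high≤numEdges*k : D * sum high ≤ numEdges H * k
        D*∑high≤numEdges*k = begin
          D * sum high               ≡⟨ *-distribˡ-sum D high ⟩
          sum (λ y → D * high y)     ≤⟨ sum-mono-≤ D*high≤degree ⟩
          sum degree                 ≡⟨ ∑degree≡numEdges*k ⟩
          numEdges H * k             ∎
          where
          open ≤-Reasoning
          D*high≤degree : ∀ y → D * high y ≤ degree y
          D*high≤degree y = bound (D ≤? degree y)
            where
            bound : (high? : Dec (D ≤ degree y)) → D * 𝟙 high? ≤ degree y
            bound (yes D≤degy) = ≤-trans (≤-reflexive (*-identityʳ D)) D≤degy
            bound (no _)       = ≤-trans (≤-reflexive (*-zeroʳ D)) z≤n

        ∑weight≤[k∸1]*[1+D*k] : sum (weight S) ≤ (k ∸ 1) * (1 + D * k)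
        ∑weight≤[k∸1]*[1+D*k] = begin
          sum (weight S)
            ≡⟨ ∑-distrib-+ (χ S) _ ⟩
          sum (χ S) + sum (λ y → sum λ s → χ S s * codegree s y)
            ≡⟨ cong₂ _+_ (sym (∣p∣≡∑χ S)) (∑-comm (λ y s → χ S s * codegree s y)) ⟩
          ∣ S ∣ + sum (λ s → sum λ y → χ S s * codegree s y)
            ≡⟨ cong (∣ S ∣ +_) (sum-cong-≗ rowSum) ⟩
          ∣ S ∣ + sum (λ s → χ S s * (degree s * k))
            ≤⟨ +-monoʳ-≤ ∣ S ∣ (∑χ*≤∣p∣* S _ (D * k) λ s∈S → *-monoˡ-≤ k (<⇒≤ (lowDegree s∈S))) ⟩
          ∣ S ∣ + ∣ S ∣ * (D * k)
            ≡⟨ sym (*-suc ∣ S ∣ (D * k)) ⟩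
          ∣ S ∣ * (1 + D * k)
            ≤⟨ *-monoˡ-≤ (1 + D * k) size ⟩
          (k ∸ 1) * (1 + D * k)  ∎
          where
          open ≤-Reasoning
          rowSum : ∀ s → sum (λ y → χ S s * codegree s y) ≡ χ S s * (degree s * k)
          rowSum s =
            trans (sym (*-distribˡ-sum (χ S s) (codegree s))) (cong (χ S s *_) (∑codegree≡degree*k s))

        remote⇒ℓ∸2≤markedDegree : ∀ {y} → Remote S y → ℓ ∸ 2 ≤ markedDegree y
        remote⇒ℓ∸2≤markedDegree {y} remote-y =
          decidable-stable (_ ≤? _) (¬¬-map linked⇒bound (linksRemote remote-y))
          where
          linked⇒bound : ∃ (λ s → s ∈ S × Linked y s) → ℓ ∸ 2 ≤ markedDegree y
          linked⇒bound (s , s∈S , F , ℓ∸2≤∣F∣ , edgeThrough) = ≤-trans ℓ∸2≤∣F∣ (∣p∣≤sum F _ countable)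
            where
            countable : ∀ {f} → f ∈ F → 1 ≤ marked f * χ (edge f) y
            countable {f} f∈F with edgeThrough f∈F
            ... | y∈f , c , c∈f , c~s = ≤-reflexive (sym (cong₂ _*_ (𝟙≡1 (0 <? _) 0<∑) (x∈p⇒χ≡1 y∈f)))
              where
              0<∑ : 0 < sum λ z → χ (edge f) z * weight S z
              0<∑ = ≤-trans (adjacent⇒0<weight s∈S c~s)
                (≤-trans (≤-reflexive (sym (trans (cong (_* weight S c) (x∈p⇒χ≡1 c∈f)) (*-identityˡ (weight S c)))))
                         (term≤sum (λ z → χ (edge f) z * weight S z) c))

        marked*∑remote≤k∸1 : ∀ f → marked f * sum (λ y → χ (edge f) y * remote y) ≤ k ∸ 1
        marked*∑remote≤k∸1 f = bound (0 <? sum λ z → χ (edge f) z * weight S z)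
          where
          bound : (marked? : Dec (0 < sum λ z → χ (edge f) z * weight S z)) →
                  𝟙 marked? * sum (λ y → χ (edge f) y * remote y) ≤ k ∸ 1
          bound (no _) = z≤n
          bound (yes 0<∑) with 0<sum⇒∃0<term (λ z → χ (edge f) z * weight S z) 0<∑
          ... | z , 0<χw with 0<𝟙*⇒ (z ∈? edge f) (weight S z) 0<χw
          ...   | z∈f , 0<wz = begin
            1 * sum (λ y → χ (edge f) y * remote y)  ≡⟨ *-identityˡ _ ⟩
            sum (λ y → χ (edge f) y * remote y)      ≤⟨ sum≤∣p∣ (edge f - z) _ term≤1 inEdge-z ⟩
            ∣ edge f - z ∣                            ≤⟨ ∸-monoˡ-≤ 1 (x∈p⇒∣p-x∣<∣p∣ z∈f) ⟩
            ∣ edge f ∣ ∸ 1                            ≡⟨ cong (_∸ 1) (All.lookup (uniform H) (∈-lookup f)) ⟩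
            k ∸ 1                                     ∎
            where
            open ≤-Reasoning
            term≤1 : ∀ y → χ (edge f) y * remote y ≤ 1
            term≤1 y = *-mono-≤ (𝟙≤1 (y ∈? edge f)) (𝟙≤1 (remote? S y))
            inEdge-z : ∀ {y} → 0 < χ (edge f) y * remote y → y ∈ edge f - z
            inEdge-z {y} 0<term with 0<𝟙*⇒ (y ∈? edge f) (remote y) 0<term
            ... | y∈f , 0<remote =
              x∈p∧x≢y⇒x∈p-y y∈f λ { refl → m<n⇒n≢0 0<wz (proj₂ (0<𝟙⇒ (remote? S y) 0<remote)) }

        [ℓ∸2]*∑remote≤numEdges*[k∸1] : (ℓ ∸ 2) * sum remote ≤ numEdges H * (k ∸ 1)
        [ℓ∸2]*∑remote≤numEdges*[k∸1] = begin
          (ℓ ∸ 2) * sum remote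
            ≡⟨ *-distribˡ-sum (ℓ ∸ 2) remote ⟩
          sum (λ y → (ℓ ∸ 2) * remote y)
            ≤⟨ sum-mono-≤ perVertex ⟩
          sum (λ y → sum λ f → marked f * (χ (edge f) y * remote y))
            ≡⟨ ∑-comm (λ y f → marked f * (χ (edge f) y * remote y)) ⟩
          sum (λ f → sum λ y → marked f * (χ (edge f) y * remote y))
            ≡⟨ sum-cong-≗ (λ f → sym (*-distribˡ-sum (marked f) (λ y → χ (edge f) y * remote y))) ⟩
          sum (λ f → marked f * sum λ y → χ (edge f) y * remote y)
            ≤⟨ sum-mono-≤ marked*∑remote≤k∸1 ⟩
          sum {numEdges H} (λ _ → k ∸ 1)
            ≡⟨ sum-const (numEdges H) (k ∸ 1) ⟩
          numEdges H * (k ∸ 1)  ∎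
          where
          open ≤-Reasoning
          perVertex : ∀ y → (ℓ ∸ 2) * remote y ≤ sum λ f → marked f * (χ (edge f) y * remote y)
          perVertex y = bound (remote? S y)
            where
            bound : (r? : Dec (Remote S y)) →
                    (ℓ ∸ 2) * 𝟙 r? ≤ sum λ f → marked f * (χ (edge f) y * 𝟙 r?)
            bound (no _) = ≤-trans (≤-reflexive (*-zeroʳ (ℓ ∸ 2))) z≤n
            bound (yes r) = begin
              (ℓ ∸ 2) * 1                                ≡⟨ *-identityʳ (ℓ ∸ 2) ⟩
              ℓ ∸ 2                                      ≤⟨ remote⇒ℓ∸2≤markedDegree {y} r ⟩
              markedDegree y
                ≡⟨ sum-cong-≗ (λ f → cong (marked f *_) (sym (*-identityʳ _))) ⟩
              sum (λ f → marked f * (χ (edge f) y * 1))  ∎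

m≤2*[m∸1] : ∀ {m} → 2 ≤ m → m ≤ 2 * (m ∸ 1)
m≤2*[m∸1] {suc zero}    (s≤s ())
m≤2*[m∸1] {suc (suc m)} _ = s≤s (subst (suc m ≤_) (cong (m +_) (sym (+-identityʳ (suc m)))) (m≤n+m (suc m) m))

-- Multiply L n ≤ L h + L C + K M by (m + 1)², use (m + 1) L h ≤ K M and (m + 1)² C ≤ n, and cancel m + 2.
split-bound : ∀ m L K k M n h W r C → k ≤ 2 * K →
  n ≤ h + W + r → L * r ≤ M * K → 2 * suc m * L * h ≤ M * k → W ≤ C → suc m * suc m * C ≤ n →
  m * L * n ≤ suc m * K * M
split-bound m L K k M n h W r C k≤2K n≤h+W+r Lr≤MK Dh≤Mk W≤C [m+1]²C≤n =
  *-cancelʳ-≤ (m * L * n) (suc m * K * M) (suc (suc m)) (+-cancelʳ-≤ (L * n) _ _ (begin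
    m * L * n * suc (suc m) + L * n                    ≡⟨ solve (m ∷ L ∷ n ∷ []) ⟩
    suc m * (suc m * (L * n))                          ≤⟨ *-monoʳ-≤ (suc m) (*-monoʳ-≤ (suc m) Ln≤) ⟩
    suc m * (suc m * (L * h + L * C + K * M))          ≡⟨ solve (m ∷ L ∷ h ∷ C ∷ K ∷ M ∷ []) ⟩
    suc m * (suc m * L * h) + suc m * suc m * (K * M)
      + L * (suc m * suc m * C)                        ≤⟨ +-mono-≤ (+-monoˡ-≤ _ (*-monoʳ-≤ (suc m) [m+1]Lh≤KM))
                                                                   (*-monoʳ-≤ L [m+1]²C≤n) ⟩
    suc m * (K * M) + suc m * suc m * (K * M) + L * n  ≡⟨ cong (_+ L * n) (solve (m ∷ K ∷ M ∷ [])) ⟩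
    suc m * K * M * suc (suc m) + L * n                ∎))
  where
  open ≤-Reasoning
  [m+1]Lh≤KM : suc m * L * h ≤ K * M
  [m+1]Lh≤KM = *-cancelˡ-≤ 2 (begin
    2 * (suc m * L * h)  ≡⟨ solve (m ∷ L ∷ h ∷ []) ⟩
    2 * suc m * L * h    ≤⟨ Dh≤Mk ⟩
    M * k                ≤⟨ *-monoʳ-≤ M k≤2K ⟩
    M * (2 * K)          ≡⟨ solve (M ∷ K ∷ []) ⟩
    2 * (K * M)          ∎)
  Ln≤ : L * n ≤ L * h + L * C + K * M
  Ln≤ = begin
    L * n                  ≤⟨ *-monoʳ-≤ L n≤h+W+r ⟩
    L * (h + W + r)        ≡⟨ solve (L ∷ h ∷ W ∷ r ∷ []) ⟩
    L * h + L * W + L * r  ≤⟨ +-mono-≤ (+-monoʳ-≤ (L * h) (*-monoʳ-≤ L W≤C)) (subst (L * r ≤_) (*-comm M K) Lr≤MK) ⟩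
    L * h + L * C + K * M  ∎

theorem2p1 : (k ℓ : ℕ) → 2 ≤ k → 3 ≤ ℓ →
    (m : ℕ) → 1 ≤ m →
    ∃ λ N → (n : ℕ) → N ≤ n →
      (H : Hypergraph n k) → BergeKSaturated ℓ H →
      (m ∸ 1) * (ℓ ∸ 2) * n ≤ m * (k ∸ 1) * numEdges H
theorem2p1 k ℓ 2≤k _ (suc m) _ = N , λ n N≤n H saturated →
  let open SaturatedHypergraph H saturated in
  decidable-stable (_ ≤? _) (¬¬-map (λ (S , linking) →
    let open Counting 2≤k D linking in
    split-bound m (ℓ ∸ 2) (k ∸ 1) k (numEdges H) n _ _ _ C (m≤2*[m∸1] 2≤k)
      n≤∑high+∑weight+∑remote [ℓ∸2]*∑remote≤numEdges*[k∸1] D*∑high≤numEdges*k ∑weight≤[k∸1]*[1+D*k] N≤n)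
    (linkingSet-exists 2≤k D))
  where
  D = 2 * suc m * (ℓ ∸ 2)
  C = (k ∸ 1) * (1 + D * k)
  N = suc m * suc m * C
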